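{- Let $n\ge 2$ and let $M$ be the Möbius ladder of order $2n$ with rim $C$. If $x,x'$ are nearly antipodal vertices of $M$, then the graph $M-\{x,x'\}$ is bipartite.
   Context: The Möbius ladder of order $2n$ is the cubic graph $M$ obtained from a cycle $C$ of length $2n$ by adding $n$ new edges, each joining a pair of vertices at distance $n$ on $C$ (opposite vertices). $C$ is called the rim and the added edges the rungs. Two vertices of $M$ are nearly antipodal if they are at distance $n-1$ in $C$. -}

module Defs where

open import Data.Nat using (ℕ; suc; _+_; _*_; _∸_; _%_; NonZero)
open import Data.Nat.Properties using (m*n≢0)
open import Data.Fin using (Fin; toℕ)
open import Data.Bool using (Bool)
open import Data.Sum using (_⊎_)
open import Data.Product using (Σ)
open import Relation.Binary.PropositionalEquality using (_≡_)
open import Relation.Nullary using (¬_)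

-- Möbius ladder of order 2n.  Vertices: Fin (2 * n), labelled in rim order,
-- so the rim C is the cycle 0 - 1 - ... - (2n-1) - 0.
-- Arithmetic on labels is modulo 2n.

module _ (n : ℕ) .{{_ : NonZero n}} where

  private
    instance
      nz2n : NonZero (2 * n)
      nz2n = m*n≢0 2 n

  shift : Fin (2 * n) → ℕ → ℕ
  shift i k = (toℕ i + k) % (2 * n)

  RimEdge : Fin (2 * n) → Fin (2 * n) → Set
  RimEdge i j = (toℕ j ≡ shift i 1) ⊎ (toℕ i ≡ shift j 1)

  Rung : Fin (2 * n) → Fin (2 * n) → Set
  Rung i j = toℕ j ≡ shift i n

  MobiusAdj : Fin (2 * n) → Fin (2 * n) → Set
  MobiusAdj i j = RimEdge i j ⊎ Rung i j

  NearlyAntipodal : Fin (2 * n) → Fin (2 * n) → Set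
  NearlyAntipodal x x' = (toℕ x' ≡ shift x (n ∸ 1)) ⊎ (toℕ x ≡ shift x' (n ∸ 1))

  -- M - {x, x'} is bipartite: a 2-colouring of all vertices which is proper
  -- on every edge of M with both ends outside {x, x'} (colours on x, x'
  -- are irrelevant).
  MinusBipartite : Fin (2 * n) → Fin (2 * n) → Set
  MinusBipartite x x' =
    Σ (Fin (2 * n) → Bool) λ c →
      ∀ u v → ¬ (u ≡ x) → ¬ (u ≡ x') → ¬ (v ≡ x) → ¬ (v ≡ x') →
        MobiusAdj u v → ¬ (c u ≡ c v)

-- Rotate the labels so that x sits at 0; then x' sits at n - 1.  Colour a
-- label d < n by the parity of d and a label n + k by the opposite parity of
-- k.  Every rung joins d to n + d and so changes colour, and every rim edge
-- changes colour except the two edges (n - 1, n) and (2n - 1, 0), which are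
-- exactly the rim edges at x' and at x.
module Submission where

open import Defs
open import Data.Nat using (ℕ; zero; suc; pred; _+_; _*_; _∸_; _%_; _≤_; _<_; _<?_; NonZero; >-nonZero⁻¹)
open import Data.Nat.Properties
open import Algebra.Properties.CommutativeSemigroup +-commutativeSemigroup using (xy∙z≈xz∙y)
open import Data.Nat.DivMod using (%-distribˡ-+; m%n%n≡m%n; [m+n]%n≡m%n; n%n≡0; m%n<n; m<n⇒m%n≡m)
open import Data.Fin using (Fin; toℕ)
open import Data.Fin.Properties using (toℕ-injective; toℕ<n)
open import Data.Bool using (Bool; false; not)
open import Data.Bool.Properties using (not-¬)
open import Data.Sum using (inj₁; inj₂)
open import Data.Product using (_,_)
open import Relation.Binary.PropositionalEquality
open import Function using (_∘′_)
open import Relation.Nullary using (yes; no; contradiction)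

[m%n+k]%n≡[m+k]%n : ∀ m k n .{{_ : NonZero n}} → (m % n + k) % n ≡ (m + k) % n
[m%n+k]%n≡[m+k]%n m k n = begin
  (m % n + k) % n          ≡⟨ %-distribˡ-+ (m % n) k n ⟩
  (m % n % n + k % n) % n  ≡⟨ cong (λ r → (r + k % n) % n) (m%n%n≡m%n m n) ⟩
  (m % n + k % n) % n      ≡⟨ %-distribˡ-+ m k n ⟨
  (m + k) % n              ∎
  where open ≡-Reasoning

suc%≢0⇒suc< : ∀ {d N} .{{_ : NonZero N}} → d < N → suc d % N ≢ 0 → suc d < N
suc%≢0⇒suc< {d} {N} d<N suc%≢0 with m≤n⇒m<n∨m≡n d<N
... | inj₁ suc<N  = suc<N
... | inj₂ refl   = contradiction (n%n≡0 N) suc%≢0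

module RimOffset {N : ℕ} .{{_ : NonZero N}} (o : Fin N) where

  offset : Fin N → ℕ
  offset v = (toℕ v + (N ∸ toℕ o)) % N

  offset<N : ∀ v → offset v < N
  offset<N v = m%n<n _ N

  offset-self : offset o ≡ 0
  offset-self = trans (cong (_% N) (m+[n∸m]≡n (<⇒≤ (toℕ<n o)))) (n%n≡0 N)

  offset-shift : ∀ i j k → toℕ j ≡ (toℕ i + k) % N → offset j ≡ (offset i + k) % N
  offset-shift i j k j≡i+k = begin
    (toℕ j + b) % N            ≡⟨ cong (λ r → (r + b) % N) j≡i+k ⟩
    ((toℕ i + k) % N + b) % N  ≡⟨ [m%n+k]%n≡[m+k]%n (toℕ i + k) b N ⟩
    (toℕ i + k + b) % N        ≡⟨ cong (_% N) (xy∙z≈xz∙y (toℕ i) k b) ⟩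
    (toℕ i + b + k) % N        ≡⟨ [m%n+k]%n≡[m+k]%n (toℕ i + b) k N ⟨
    (offset i + k) % N         ∎
    where
      open ≡-Reasoning
      b = N ∸ toℕ o

  private
    offset-inverse : ∀ v → (offset v + toℕ o) % N ≡ toℕ v
    offset-inverse v = begin
      (offset v + toℕ o) % N             ≡⟨ [m%n+k]%n≡[m+k]%n (toℕ v + (N ∸ toℕ o)) (toℕ o) N ⟩
      (toℕ v + (N ∸ toℕ o) + toℕ o) % N  ≡⟨ cong (_% N) (+-assoc (toℕ v) _ (toℕ o)) ⟩
      (toℕ v + (N ∸ toℕ o + toℕ o)) % N  ≡⟨ cong (λ r → (toℕ v + r) % N) (m∸n+n≡m (<⇒≤ (toℕ<n o))) ⟩
      (toℕ v + N) % N                    ≡⟨ [m+n]%n≡m%n (toℕ v) N ⟩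
      toℕ v % N                          ≡⟨ m<n⇒m%n≡m (toℕ<n v) ⟩
      toℕ v                              ∎
      where open ≡-Reasoning

  offset-injective : ∀ u v → offset u ≡ offset v → u ≡ v
  offset-injective u v eq = toℕ-injective (begin
    toℕ u                   ≡⟨ offset-inverse u ⟨
    (offset u + toℕ o) % N  ≡⟨ cong (λ r → (r + toℕ o) % N) eq ⟩
    (offset v + toℕ o) % N  ≡⟨ offset-inverse v ⟩
    toℕ v                   ∎)
    where open ≡-Reasoning

alternate : ℕ → Bool
alternate zero    = false
alternate (suc d) = not (alternate d)

module LadderColouring (n : ℕ) .{{_ : NonZero n}} where

  instance
    2n≢0 : NonZero (2 * n)
    2n≢0 = m*n≢0 2 n

  colour : ℕ → Bool
  colour d with d <? n
  ... | yes _ = alternate d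
  ... | no  _ = not (alternate (d ∸ n))

  colour-lower : ∀ {d} → d < n → colour d ≡ alternate d
  colour-lower {d} d<n with d <? n
  ... | yes _   = refl
  ... | no  d≮n = contradiction d<n d≮n

  colour-upper : ∀ k → colour (n + k) ≡ not (alternate k)
  colour-upper k with n + k <? n
  ... | yes n+k<n = contradiction n+k<n (≤⇒≯ (m≤m+n n k))
  ... | no  _     = cong (not ∘′ alternate) (m+n∸m≡n n k)

  n+n≡2n : n + n ≡ 2 * n
  n+n≡2n = cong (n +_) (sym (+-identityʳ n))

  data Half : ℕ → Set where
    lower : ∀ {d} → d < n → Half d
    upper : ∀ {k} → k < n → Half (n + k)

  half : ∀ {d} → d < 2 * n → Half d
  half {d} d<2n with d <? n
  ... | yes d<n = lower d<n
  ... | no  d≮n with m≤n⇒∃[o]m+o≡n (≮⇒≥ d≮n)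
  ...   | k , refl = upper (+-cancelˡ-< n k n (subst (n + k <_) (sym n+n≡2n) d<2n))

  colour-flip : ∀ {a c} b → colour a ≡ b → colour c ≡ not b → colour a ≢ colour c
  colour-flip b ca≡b cc≡¬b ca≡cc = not-¬ refl (trans (sym ca≡b) (trans ca≡cc cc≡¬b))

  colour-rung : ∀ {d} → d < 2 * n → colour d ≢ colour ((d + n) % (2 * n))
  colour-rung d<2n with half d<2n
  ... | lower {d} d<n = colour-flip (alternate d) (colour-lower d<n) (begin
    colour ((d + n) % (2 * n))  ≡⟨ cong colour (m<n⇒m%n≡m (subst (d + n <_) n+n≡2n (+-monoˡ-< n d<n))) ⟩
    colour (d + n)              ≡⟨ cong colour (+-comm d n) ⟩
    colour (n + d)              ≡⟨ colour-upper d ⟩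
    not (alternate d)           ∎)
    where open ≡-Reasoning
  ... | upper {k} k<n = colour-flip (alternate k) (begin
    colour ((n + k + n) % (2 * n))  ≡⟨ cong (λ m → colour (m % (2 * n))) n+k+n≡k+2n ⟩
    colour ((k + 2 * n) % (2 * n))  ≡⟨ cong colour ([m+n]%n≡m%n k (2 * n)) ⟩
    colour (k % (2 * n))            ≡⟨ cong colour (m<n⇒m%n≡m (<-≤-trans k<n (m≤m+n n (n + 0)))) ⟩
    colour k                        ≡⟨ colour-lower k<n ⟩
    alternate k                     ∎) (colour-upper k) ∘′ sym
    where
      open ≡-Reasoning
      n+k+n≡k+2n : n + k + n ≡ k + 2 * n
      n+k+n≡k+2n = trans (cong (_+ n) (+-comm n k)) (trans (+-assoc k n n) (cong (k +_) n+n≡2n))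

  colour-rim : ∀ {d} → suc d < 2 * n → d ≢ n ∸ 1 → colour d ≢ colour (suc d)
  colour-rim sd<2n d≢n-1 with half (<⇒≤ sd<2n)
  ... | lower {d} d<n with m≤n⇒m<n∨m≡n d<n
  ...   | inj₁ sd<n = colour-flip (alternate d) (colour-lower d<n) (colour-lower sd<n)
  ...   | inj₂ sd≡n = contradiction (cong pred sd≡n) d≢n-1
  colour-rim _ _ | upper {k} _ =
    colour-flip (not (alternate k)) (colour-upper k) (trans (cong colour (sym (+-suc n k))) (colour-upper (suc k)))

  colour-rim-mod : ∀ {d} → d < 2 * n → d ≢ n ∸ 1 → (d + 1) % (2 * n) ≢ 0 →
                   colour d ≢ colour ((d + 1) % (2 * n))
  colour-rim-mod {d} d<2n d≢n-1 wrap rewrite +-comm d 1 =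
    subst (λ c → colour d ≢ colour c) (sym (m<n⇒m%n≡m sd<2n)) (colour-rim sd<2n d≢n-1)
    where sd<2n = suc%≢0⇒suc< d<2n wrap

  n∸1<2n : n ∸ 1 < 2 * n
  n∸1<2n = ≤-<-trans (m∸n≤m n 1) (subst (n <_) n+n≡2n (m<m+n n (>-nonZero⁻¹ n)))

  minusBipartite-nearlyAntipodal : (x x' : Fin (2 * n)) → toℕ x' ≡ shift n x (n ∸ 1) → MinusBipartite n x x'
  minusBipartite-nearlyAntipodal x x' x'≡x+n-1 = colour ∘′ offset , proper
    where
      open RimOffset x

      offset≢0 : ∀ {v} → v ≢ x → offset v ≢ 0
      offset≢0 {v} v≢x off≡0 = v≢x (offset-injective v x (trans off≡0 (sym offset-self)))

      offset≢n-1 : ∀ {u} → u ≢ x' → offset u ≢ n ∸ 1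
      offset≢n-1 {u} u≢x' off≡n-1 = u≢x' (offset-injective u x' (trans off≡n-1 (sym x'-offset)))
        where
          open ≡-Reasoning
          x'-offset : offset x' ≡ n ∸ 1
          x'-offset = begin
            offset x'                       ≡⟨ offset-shift x x' (n ∸ 1) x'≡x+n-1 ⟩
            (offset x + (n ∸ 1)) % (2 * n)  ≡⟨ cong (λ r → (r + (n ∸ 1)) % (2 * n)) offset-self ⟩
            (n ∸ 1) % (2 * n)               ≡⟨ m<n⇒m%n≡m n∸1<2n ⟩
            n ∸ 1                           ∎

      rim : ∀ {u v} → toℕ v ≡ shift n u 1 → u ≢ x' → v ≢ x → colour (offset u) ≢ colour (offset v)
      rim {u} {v} v≡u+1 u≢x' v≢x with offset v | offset-shift u v 1 v≡u+1 | offset≢0 v≢x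
      ... | _ | refl | off≢0 = colour-rim-mod (offset<N u) (offset≢n-1 u≢x') off≢0

      rung : ∀ {u v} → toℕ v ≡ shift n u n → colour (offset u) ≢ colour (offset v)
      rung {u} {v} v≡u+n =
        subst (λ c → colour (offset u) ≢ colour c) (sym (offset-shift u v n v≡u+n)) (colour-rung (offset<N u))

      proper : ∀ u v → u ≢ x → u ≢ x' → v ≢ x → v ≢ x' →
               MobiusAdj n u v → colour (offset u) ≢ colour (offset v)
      proper u v _   u≢x' v≢x _    (inj₁ (inj₁ v≡u+1)) = rim v≡u+1 u≢x' v≢x
      proper u v u≢x _    _   v≢x' (inj₁ (inj₂ u≡v+1)) = rim u≡v+1 v≢x' u≢x ∘′ sym
      proper u v _   _    _   _    (inj₂ v≡u+n)        = rung v≡u+n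

MinusBipartite-sym : ∀ n .{{_ : NonZero n}} x x' → MinusBipartite n x x' → MinusBipartite n x' x
MinusBipartite-sym n x x' (c , proper) = c , λ u v u≢x' u≢x v≢x' v≢x → proper u v u≢x u≢x' v≢x v≢x'

mainTheorem8 : (n : ℕ) .{{_ : NonZero n}} → 2 ≤ n →
    (x x' : Fin (2 * n)) → NearlyAntipodal n x x' → MinusBipartite n x x'
mainTheorem8 n _ x x' (inj₁ x'≡x+n-1) = LadderColouring.minusBipartite-nearlyAntipodal n x x' x'≡x+n-1
mainTheorem8 n _ x x' (inj₂ x≡x'+n-1) = MinusBipartite-sym n x' x (LadderColouring.minusBipartite-nearlyAntipodal n x' x x≡x'+n-1)
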